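{- Let $r,r'$ be rigid expressions with $r\asymp r'$. Then: (1) if $L(r)\cong L(r')$ then $r\cong r'$; (2) if $\mathrm{NF}(r)\cong\mathrm{NF}(r')$ then $r\cong r'$.
   Context: Rigid terms and monomials: $a,b,c ::= x\mid\lambda x.a\mid\langle a\rangle\vec b\mid a\oplus\bullet\mid\bullet\oplus a$, $\vec b::=(b_1,\dots,b_n)$ (finite lists; $|\vec b|=n$, $::$ concatenation), up to $\alpha$-equivalence; $n_x(r)$ counts free occurrences of $x$; $\lambda\vec x$ is a possibly empty sequence of abstractions. Partial rigid expressions are rigid expressions or a formal element $0$, which is absorbing for all constructors. Rigid substitution, for $|\vec b|=n_x(r)$: $x[(b)/x]=b$, $y[()/x]=y$ ($y\ne x$), $(\lambda z.a)[\vec b/x]=\lambda z.a[\vec b/x]$ ($z$ fresh), $(a\oplus\bullet)[\vec b/x]=a[\vec b/x]\oplus\bullet$, $(\bullet\oplus a)[\vec b/x]=\bullet\oplus a[\vec b/x]$, $(\langle c\rangle\vec d)[\vec b_0::\vec b_1/x]=\langle c[\vec b_0/x]\rangle\vec d[\vec b_1/x]$ with $|\vec b_0|=n_x(c)$, $|\vec b_1|=n_x(\vec d)$, $(a_1,\dots,a_n)[\vec b_1::\cdots::\vec b_n/x]=(a_1[\vec b_1/x],\dots,a_n[\vec b_n/x])$ with $|\vec b_i|=n_x(a_i)$; otherwise $r[\vec b/x]=0$. The rigid hereditary head reduction $L$: $L(a\oplus\bullet)=L(a)\oplus\bullet$; $L(\bullet\oplus a)=\bullet\oplus L(a)$; $L(\lambda\vec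 x.\lambda y.(a\oplus\bullet))=\lambda\vec x.((\lambda y.a)\oplus\bullet)$; $L(\lambda\vec x.\lambda y.(\bullet\oplus a))=\lambda\vec x.(\bullet\oplus\lambda y.a)$; $L(\lambda\vec x.\langle\langle a\oplus\bullet\rangle\vec b\rangle\vec c_1\cdots\vec c_k)=\lambda\vec x.\langle(\langle a\rangle\vec b)\oplus\bullet\rangle\vec c_1\cdots\vec c_k$; $L(\lambda\vec x.\langle\langle\bullet\oplus a\rangle\vec b\rangle\vec c_1\cdots\vec c_k)=\lambda\vec x.\langle\bullet\oplus\langle a\rangle\vec b\rangle\vec c_1\cdots\vec c_k$; $L(\lambda\vec x.\langle y\rangle\vec a_1\cdots\vec a_k)=\lambda\vec x.\langle y\rangle L(\vec a_1)\cdots L(\vec a_k)$; $L((a_1,\dots,a_k))=(L(a_1),\dots,L(a_k))$; $L(\lambda\vec x.\langle\lambda y.a\rangle\vec b\,\vec c_1\cdots\vec c_k)=\lambda\vec x.\langle a[\vec b/y]\rangle\vec c_1\cdots\vec c_k$; $L(0)=0$. For every $r$ there is $k$ with $L^{k+1}(r)=L^k(r)$, and $\mathrm{NF}(r)$ denotes $L^k(r)$ for such $k$. The relation $\cong$ holds only between rigid expressions (never involving $0$): it is generated by $x\cong x$; $\lambda x.a\cong\lambda x.a'$, $a\oplus\bullet\cong a'\oplus\bullet$, $\bullet\oplus a\cong\bullet\oplus a'$ if $a\cong a'$; $\langle c\rangle\vec d\cong\langle c'\rangle\vec d'$ if $c\cong c'$ and $\vec d\cong\vec d'$; $(a_1,\dots,a_n)\cong(a'_1,\dots,a'_n)$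 if there is $\sigma\in\mathfrak S_n$ with $a_i\cong a'_{\sigma(i)}$ for all $i$ (equivalently, the two expressions become equal after replacing every list by the multiset of its elements). Rigid coherence $\asymp$: $x\asymp x$; $\lambda x.a\asymp\lambda x.a'$ if $a\asymp a'$; $\langle c\rangle\vec d\asymp\langle c'\rangle\vec d'$ if $c\asymp c'$ and $\vec d\asymp\vec d'$; $(b_1,\dots,b_n)\asymp(b_{n+1},\dots,b_{n+m})$ if $b_i\asymp b_j$ for all $1\le i,j\le n+m$; $a\oplus\bullet\asymp a'\oplus\bullet$ and $\bullet\oplus a\asymp\bullet\oplus a'$ if $a\asymp a'$; $a\oplus\bullet\asymp\bullet\oplus a'$ for all $a,a'$ (symmetric). -}

module Defs where

open import Data.Nat using (ℕ; zero; suc; _+_; _<ᵇ_; _≡ᵇ_; pred)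
open import Data.Bool using (Bool; true; false; if_then_else_)
open import Data.List using (List; []; _∷_; _++_; length; take; drop)
open import Data.Maybe using (Maybe; just; nothing)
open import Data.Product using (_×_; ∃-syntax)
open import Data.List.Relation.Unary.All using (All)
open import Data.List.Relation.Binary.Pointwise using (Pointwise)
open import Data.List.Relation.Binary.Permutation.Propositional using (_↭_)
open import Relation.Binary.PropositionalEquality using (_≡_)

-- Rigid terms, with de Bruijn indices (so α-equivalence is equality).
--   var x        : x
--   lam a        : λ x . a   (the bound variable is index 0)
--   app c bs     : ⟨ c ⟩ bs  (bs a rigid monomial = finite list of terms)
--   plusL a      : a ⊕ •
--   plusR a      : • ⊕ a

data Term : Set where
  var   : ℕ → Term
  lam   : Term → Term
  app   : Term → List Term → Term
  plusL : Term → Term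
  plusR : Term → Term

Mono : Set
Mono = List Term

data Sort : Set where
  tm mono : Sort

Exp : Sort → Set
Exp tm   = Term
Exp mono = Mono

-- Partial rigid expressions: Maybe, with nothing playing the role of 0
-- (absorbing for all constructors, via the helpers below).

mapM : {A B : Set} → (A → B) → Maybe A → Maybe B
mapM f (just a) = just (f a)
mapM f nothing  = nothing

map2M : {A B C : Set} → (A → B → C) → Maybe A → Maybe B → Maybe C
map2M f (just a) (just b) = just (f a b)
map2M f _        _        = nothing

mutual
  occ : ℕ → Term → ℕ
  occ k (var y)   = if y ≡ᵇ k then 1 else 0
  occ k (lam a)   = occ (suc k) a
  occ k (app c d) = occ k c + occM k d
  occ k (plusL a) = occ k a
  occ k (plusR a) = occ k a

  occM : ℕ → Mono → ℕ
  occM k []       = 0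
  occM k (a ∷ as) = occ k a + occM k as

mutual
  shift : ℕ → Term → Term
  shift c (var y)   = var (if y <ᵇ c then y else suc y)
  shift c (lam a)   = lam (shift (suc c) a)
  shift c (app a d) = app (shift c a) (shiftM c d)
  shift c (plusL a) = plusL (shift c a)
  shift c (plusR a) = plusR (shift c a)

  shiftM : ℕ → Mono → Mono
  shiftM c []       = []
  shiftM c (a ∷ as) = shift c a ∷ shiftM c as

-- Rigid substitution  r[bs / k]  (k a de Bruijn index; the variable k is
-- removed, free indices above k are decremented).  Yields nothing (= 0)
-- unless |bs| = n_k(r); lists are split according to occurrence counts.

mutual
  subst : ℕ → Term → List Term → Maybe Term
  subst k (var y) bs with y ≡ᵇ k | bs
  ... | true  | b ∷ [] = just b
  ... | true  | _      = nothing
  ... | false | []     = just (var (if y <ᵇ k then y else pred y))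
  ... | false | _ ∷ _  = nothing
  subst k (lam a)   bs = mapM lam (subst (suc k) a (shiftM 0 bs))
  subst k (app c d) bs =
    map2M app (subst k c (take (occ k c) bs)) (substM k d (drop (occ k c) bs))
  subst k (plusL a) bs = mapM plusL (subst k a bs)
  subst k (plusR a) bs = mapM plusR (subst k a bs)

  substM : ℕ → Mono → List Term → Maybe Mono
  substM k []       []      = just []
  substM k []       (_ ∷ _) = nothing
  substM k (a ∷ as) bs =
    map2M _∷_ (subst k a (take (occ k a) bs)) (substM k as (drop (occ k a) bs))

-- Rigid hereditary head reduction L.
-- A term is  λx⃗. ⟨…⟨h⟩ c⃗₁ …⟩ c⃗ₖ  with h not an application.

varHead : Term → Bool
varHead (var _)   = true
varHead (app c _) = varHead c
varHead _         = false

mutual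
  Lt : Term → Maybe Term
  Lt (var y)           = just (var y)
  Lt (lam (plusL a))   = just (plusL (lam a))
  Lt (lam (plusR a))   = just (plusR (lam a))
  Lt (lam a)           = mapM lam (Lt a)
  Lt (plusL a)         = mapM plusL (Lt a)
  Lt (plusR a)         = mapM plusR (Lt a)
  Lt (app (var y) d)   = mapM (app (var y)) (LM d)
  Lt (app (lam a) d)   = subst 0 a d
  Lt (app (plusL a) d) = just (plusL (app a d))
  Lt (app (plusR a) d) = just (plusR (app a d))
  Lt (app (app c e) d) =
    if varHead c
    then map2M app (Lt (app c e)) (LM d)
    else mapM (λ u → app u d) (Lt (app c e))

  LM : Mono → Maybe Mono
  LM []       = just []
  LM (a ∷ as) = map2M _∷_ (Lt a) (LM as)

L : (s : Sort) → Maybe (Exp s) → Maybe (Exp s)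
L s nothing        = nothing
L tm   (just r)    = Lt r
L mono (just r)    = LM r

Lⁿ : (s : Sort) → ℕ → Maybe (Exp s) → Maybe (Exp s)
Lⁿ s zero    r = r
Lⁿ s (suc n) r = L s (Lⁿ s n r)

mutual
  data _≅_ : Term → Term → Set where
    var   : ∀ {x} → var x ≅ var x
    lam   : ∀ {a a'} → a ≅ a' → lam a ≅ lam a'
    app   : ∀ {c c' d d'} → c ≅ c' → d ≅ᴹ d' → app c d ≅ app c' d'
    plusL : ∀ {a a'} → a ≅ a' → plusL a ≅ plusL a'
    plusR : ∀ {a a'} → a ≅ a' → plusR a ≅ plusR a'

  -- (a₁,…,aₙ) ≅ (a'₁,…,a'ₙ) iff there is σ with aᵢ ≅ a'_{σ(i)}:
  -- i.e. as is a permutation of some cs which is pointwise ≅ to as'.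
  data _≅ᴹ_ : Mono → Mono → Set where
    perm : ∀ {as as'} cs → as ↭ cs → Pointwise _≅_ cs as' → as ≅ᴹ as'

Cong : (s : Sort) → Exp s → Exp s → Set
Cong tm   = _≅_
Cong mono = _≅ᴹ_

data CongP (s : Sort) : Maybe (Exp s) → Maybe (Exp s) → Set where
  just : ∀ {r r'} → Cong s r r' → CongP s (just r) (just r')

mutual
  data _≍_ : Term → Term → Set where
    var    : ∀ {x} → var x ≍ var x
    lam    : ∀ {a a'} → a ≍ a' → lam a ≍ lam a'
    app    : ∀ {c c' d d'} → c ≍ c' → d ≍ᴹ d' → app c d ≍ app c' d'
    plusL  : ∀ {a a'} → a ≍ a' → plusL a ≍ plusL a'
    plusR  : ∀ {a a'} → a ≍ a' → plusR a ≍ plusR a'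
    plusLR : ∀ {a a'} → plusL a ≍ plusR a'
    plusRL : ∀ {a a'} → plusR a ≍ plusL a'

  data _≍ᴹ_ : Mono → Mono → Set where
    coh : ∀ {bs bs'} →
          All (λ b → All (λ b' → b ≍ b') (bs ++ bs')) (bs ++ bs') →
          bs ≍ᴹ bs'

Coh : (s : Sort) → Exp s → Exp s → Set
Coh tm   = _≍_
Coh mono = _≍ᴹ_

-- NF(r) = Lᵏ(r) for any k with L^{k+1}(r) = Lᵏ(r)
IsNFIndex : (s : Sort) → Exp s → ℕ → Set
IsNFIndex s r k = Lⁿ s (suc k) (just r) ≡ Lⁿ s k (just r)

module Submission where

-- The heart of the proof is that one step of L reflects ≅ on coherent pairs.
-- L either rearranges constructors (invertible), recurses, or performs a rigid
-- substitution a[bs/x]; so we first show that rigid substitution reflects ≅: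
-- from a ≍ a' and a[bs/x] ≅ a'[bs'/x] we get a ≅ a' and bs ≅ bs'.  Coherence is
-- what makes this work inside monomials: the permutation witnessing ≅ on the
-- results can be pulled back to the arguments, and the paired elements are
-- coherent, so induction applies to them.  Under binders the arguments are
-- shifted, and shifting reflects ≅ because it has a left inverse preserving ≅.
--
-- To iterate, we also show that L (through substitution and shifting) preserves
-- coherence.  Phrased for partial expressions, L then reflects ≅ and preserves
-- coherence, so Lⁿ reflects ≅ for every n.  Part (1) is the case n = 1; part (2)
-- follows since NF(r) = Lᵐ(r) for every m beyond a normalisation index.

open import Defs
open import Data.Nat using (ℕ; zero; suc; _+_; _<ᵇ_; _≡ᵇ_; pred)
open import Data.Nat.Properties using (+-comm)
open import Data.Bool using (Bool; true; false; if_then_else_)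
open import Data.List using (List; []; _∷_; _++_; take; drop; map; concat)
open import Data.List.Properties using (take++drop≡id)
open import Data.Maybe using (Maybe; just; nothing)
open import Data.Sum using (_⊎_; inj₁; inj₂)
open import Data.Product using (_×_; _,_; proj₁; proj₂; ∃-syntax)
open import Data.List.Relation.Unary.All using (All; []; _∷_)
import Data.List.Relation.Unary.All as All
open import Data.List.Relation.Unary.Any using (here; there)
open import Data.List.Relation.Binary.Pointwise using (Pointwise; []; _∷_)
import Data.List.Relation.Binary.Pointwise as Pointwise
open import Data.List.Relation.Binary.Permutation.Propositional
  using (_↭_; refl; prep; swap; trans; ↭-sym)
import Data.List.Relation.Binary.Permutation.Propositional.Properties as ↭
open import Data.List.Membership.Propositional using (_∈_)
open import Data.List.Membership.Propositional.Properties using (∈-++⁺ˡ; ∈-++⁺ʳ; ∈-map⁺; ∈-map⁻)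
open import Data.List.Relation.Binary.Subset.Propositional using (_⊆_)
import Data.List.Relation.Binary.Subset.Propositional.Properties as ⊆
open import Data.List.Relation.Binary.Sublist.Propositional using (lookup)
open import Data.List.Relation.Binary.Sublist.Propositional.Properties using (take-⊆; drop-⊆)
open import Relation.Binary.PropositionalEquality
  using (_≡_; refl; sym; cong; cong₂; subst₂)
  renaming (trans to ≡-trans)

Pointwise-↭ : ∀ {A B : Set} {R : A → B → Set} {xs : List A} {ys zs : List B} →
  Pointwise R xs ys → ys ↭ zs → ∃[ ws ] (xs ↭ ws × Pointwise R ws zs)
Pointwise-↭ rs refl = _ , refl , rs
Pointwise-↭ (r ∷ rs) (prep _ p) with Pointwise-↭ rs p
... | ws , q , rs' = _ ∷ ws , prep _ q , r ∷ rs'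
Pointwise-↭ (r₁ ∷ r₂ ∷ rs) (swap _ _ p) with Pointwise-↭ rs p
... | ws , q , rs' = _ ∷ _ ∷ ws , swap _ _ q , r₂ ∷ r₁ ∷ rs'
Pointwise-↭ rs (trans p₁ p₂) with Pointwise-↭ rs p₁
... | ws₁ , q₁ , rs₁ with Pointwise-↭ rs₁ p₂
... | ws₂ , q₂ , rs₂ = ws₂ , trans q₁ q₂ , rs₂

concat-↭ : ∀ {A : Set} {xss yss : List (List A)} → xss ↭ yss → concat xss ↭ concat yss
concat-↭ refl = refl
concat-↭ (prep xs p) = ↭.++⁺ˡ xs (concat-↭ p)
concat-↭ (swap xs ys p) = trans (↭.shifts xs ys) (↭.++⁺ˡ ys (↭.++⁺ˡ xs (concat-↭ p)))
concat-↭ (trans p q) = trans (concat-↭ p) (concat-↭ q)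

take-⊆ₛ : ∀ {A : Set} n {xs U : List A} → xs ⊆ U → take n xs ⊆ U
take-⊆ₛ n {xs} s x∈ = s (lookup (take-⊆ n xs) x∈)

drop-⊆ₛ : ∀ {A : Set} n {xs U : List A} → xs ⊆ U → drop n xs ⊆ U
drop-⊆ₛ n {xs} s x∈ = s (lookup (drop-⊆ n xs) x∈)

≅ᴹ-++ : ∀ {as as' bs bs'} → as ≅ᴹ as' → bs ≅ᴹ bs' → (as ++ bs) ≅ᴹ (as' ++ bs')
≅ᴹ-++ (perm cs p w) (perm ds q v) = perm (cs ++ ds) (↭.++⁺ p q) (Pointwise.++⁺ w v)

≅ᴹ-concat : ∀ {ass bss} → Pointwise _≅ᴹ_ ass bss → concat ass ≅ᴹ concat bss
≅ᴹ-concat [] = perm [] refl []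
≅ᴹ-concat (r ∷ rs) = ≅ᴹ-++ r (≅ᴹ-concat rs)

↭-≅ᴹ : ∀ {as bs cs} → as ↭ bs → bs ≅ᴹ cs → as ≅ᴹ cs
↭-≅ᴹ p (perm ds q w) = perm ds (trans p q) w

≅ᴹ-split : ∀ m n {as bs} → take m as ≅ᴹ take n bs → drop m as ≅ᴹ drop n bs → as ≅ᴹ bs
≅ᴹ-split m n {as} {bs} t d =
  subst₂ _≅ᴹ_ (take++drop≡id m as) (take++drop≡id n bs) (≅ᴹ-++ t d)

AllCoh : List Term → List Term → Set
AllCoh xs ys = All (λ x → All (x ≍_) ys) xs

Coherent : List Term → Set
Coherent xs = ∀ {x y} → x ∈ xs → y ∈ xs → x ≍ y

≍ᴹ⇒Coherent : ∀ {d d'} → d ≍ᴹ d' → Coherent (d ++ d')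
≍ᴹ⇒Coherent (coh A) x∈ y∈ = All.lookup (All.lookup A x∈) y∈

Coherent-map : ∀ {f : Term → Term} {xs} → (∀ {x y} → x ≍ y → f x ≍ f y) →
  Coherent xs → Coherent (map f xs)
Coherent-map {f} pres h x∈ y∈ with ∈-map⁻ f x∈ | ∈-map⁻ f y∈
... | _ , x∈' , refl | _ , y∈' , refl = pres (h x∈' y∈')

shiftM≡map : ∀ c xs → shiftM c xs ≡ map (shift c) xs
shiftM≡map c [] = refl
shiftM≡map c (x ∷ xs) = cong (shift c x ∷_) (shiftM≡map c xs)

shiftM-++ : ∀ c xs ys → shiftM c (xs ++ ys) ≡ shiftM c xs ++ shiftM c ys
shiftM-++ c [] ys = refl
shiftM-++ c (x ∷ xs) ys = cong (shift c x ∷_) (shiftM-++ c xs ys)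

mutual
  shift-≍ : ∀ c {a a'} → a ≍ a' → shift c a ≍ shift c a'
  shift-≍ c var = var
  shift-≍ c (lam q) = lam (shift-≍ (suc c) q)
  shift-≍ c (app q (coh {bs} {bs'} A)) =
    app (shift-≍ c q) (coh (subst₂ AllCoh (shiftM-++ c bs bs') (shiftM-++ c bs bs') (shift-AllCoh c A)))
  shift-≍ c (plusL q) = plusL (shift-≍ c q)
  shift-≍ c (plusR q) = plusR (shift-≍ c q)
  shift-≍ c plusLR = plusLR
  shift-≍ c plusRL = plusRL

  shift-AllCoh : ∀ c {xs ys} → AllCoh xs ys → AllCoh (shiftM c xs) (shiftM c ys)
  shift-AllCoh c [] = []
  shift-AllCoh c (row ∷ rows) = shift-All≍ c row ∷ shift-AllCoh c rows

  shift-All≍ : ∀ c {x ys} → All (x ≍_) ys → All (shift c x ≍_) (shiftM c ys)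
  shift-All≍ c [] = []
  shift-All≍ c (q ∷ qs) = shift-≍ c q ∷ shift-All≍ c qs

shift-Coherent : ∀ c {U} → Coherent U → Coherent (shiftM c U)
shift-Coherent c {U} h rewrite shiftM≡map c U = Coherent-map (shift-≍ c) h

shift-⊆ : ∀ c {xs ys} → xs ⊆ ys → shiftM c xs ⊆ shiftM c ys
shift-⊆ c {xs} {ys} s rewrite shiftM≡map c xs | shiftM≡map c ys = ⊆.map⁺ (shift c) s

mutual
  unshift : ℕ → Term → Term
  unshift c (var y)   = var (if y <ᵇ c then y else pred y)
  unshift c (lam a)   = lam (unshift (suc c) a)
  unshift c (app a d) = app (unshift c a) (unshiftM c d)
  unshift c (plusL a) = plusL (unshift c a)
  unshift c (plusR a) = plusR (unshift c a)

  unshiftM : ℕ → Mono → Mono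
  unshiftM c []       = []
  unshiftM c (a ∷ as) = unshift c a ∷ unshiftM c as

<ᵇ-suc : ∀ y c → (y <ᵇ c) ≡ false → (suc y <ᵇ c) ≡ false
<ᵇ-suc y zero _ = refl
<ᵇ-suc (suc y) (suc c) ge = <ᵇ-suc y c ge

unshift-shift-var : ∀ c y →
  (let y' = if y <ᵇ c then y else suc y in if y' <ᵇ c then y' else pred y') ≡ y
unshift-shift-var c y with y <ᵇ c in lt
... | true rewrite lt = refl
... | false rewrite <ᵇ-suc y c lt = refl

mutual
  unshift-shift : ∀ c a → unshift c (shift c a) ≡ a
  unshift-shift c (var y) = cong var (unshift-shift-var c y)
  unshift-shift c (lam a) = cong lam (unshift-shift (suc c) a)
  unshift-shift c (app a d) = cong₂ app (unshift-shift c a) (unshiftM-shiftM c d)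
  unshift-shift c (plusL a) = cong plusL (unshift-shift c a)
  unshift-shift c (plusR a) = cong plusR (unshift-shift c a)

  unshiftM-shiftM : ∀ c as → unshiftM c (shiftM c as) ≡ as
  unshiftM-shiftM c [] = refl
  unshiftM-shiftM c (a ∷ as) = cong₂ _∷_ (unshift-shift c a) (unshiftM-shiftM c as)

unshiftM-↭ : ∀ c {as bs} → as ↭ bs → unshiftM c as ↭ unshiftM c bs
unshiftM-↭ c refl = refl
unshiftM-↭ c (prep a p) = prep _ (unshiftM-↭ c p)
unshiftM-↭ c (swap a b p) = swap _ _ (unshiftM-↭ c p)
unshiftM-↭ c (trans p q) = trans (unshiftM-↭ c p) (unshiftM-↭ c q)

mutual
  unshift-≅ : ∀ c {a a'} → a ≅ a' → unshift c a ≅ unshift c a'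
  unshift-≅ c var = var
  unshift-≅ c (lam d) = lam (unshift-≅ (suc c) d)
  unshift-≅ c (app d ds) = app (unshift-≅ c d) (unshiftM-≅ᴹ c ds)
  unshift-≅ c (plusL d) = plusL (unshift-≅ c d)
  unshift-≅ c (plusR d) = plusR (unshift-≅ c d)

  unshiftM-≅ᴹ : ∀ c {as as'} → as ≅ᴹ as' → unshiftM c as ≅ᴹ unshiftM c as'
  unshiftM-≅ᴹ c (perm cs p w) = perm (unshiftM c cs) (unshiftM-↭ c p) (unshift-Pointwise c w)

  unshift-Pointwise : ∀ c {as as'} → Pointwise _≅_ as as' → Pointwise _≅_ (unshiftM c as) (unshiftM c as')
  unshift-Pointwise c [] = []
  unshift-Pointwise c (d ∷ ds) = unshift-≅ c d ∷ unshift-Pointwise c ds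

shiftM-reflects-≅ᴹ : ∀ c {as as'} → shiftM c as ≅ᴹ shiftM c as' → as ≅ᴹ as'
shiftM-reflects-≅ᴹ c {as} {as'} d =
  subst₂ _≅ᴹ_ (unshiftM-shiftM c as) (unshiftM-shiftM c as') (unshiftM-≅ᴹ c d)

mapM-just : ∀ {A B : Set} {f : A → B} {m u} → mapM f m ≡ just u → ∃[ x ] (m ≡ just x × f x ≡ u)
mapM-just {m = just x} refl = x , refl , refl

map2M-just : ∀ {A B C : Set} {f : A → B → C} {m n u} → map2M f m n ≡ just u →
  ∃[ x ] ∃[ y ] (m ≡ just x × n ≡ just y × f x y ≡ u)
map2M-just {m = just x} {just y} refl = x , y , refl , refl , refl

data VarSubst (k y : ℕ) : Bool → List Term → Term → Set where
  hit  : ∀ {u} → VarSubst k y true (u ∷ []) u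
  miss : VarSubst k y false [] (var (if y <ᵇ k then y else pred y))

varSubst : ∀ k y bs {u} → subst k (var y) bs ≡ just u → VarSubst k y (y ≡ᵇ k) bs u
varSubst k y bs e with y ≡ᵇ k | bs | e
... | true  | _ ∷ [] | refl = hit
... | false | []     | refl = miss

SubstsTo : ℕ → Term × List Term → Term → Set
SubstsTo k p c = subst k (proj₁ p) (proj₂ p) ≡ just c

substM-chunks : ∀ k d bs {u} → substM k d bs ≡ just u →
  ∃[ ps ] (map proj₁ ps ≡ d × concat (map proj₂ ps) ≡ bs × Pointwise (SubstsTo k) ps u)
substM-chunks k [] [] refl = [] , refl , refl , []
substM-chunks k (a ∷ d) bs e with map2M-just e
... | _ , _ , e₁ , e₂ , refl with substM-chunks k d (drop (occ k a) bs) e₂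
... | ps , refl , cs , w =
  (a , take (occ k a) bs) ∷ ps , refl ,
  ≡-trans (cong (take (occ k a) bs ++_) cs) (take++drop≡id (occ k a) bs) , e₁ ∷ w

mutual
  -- No coherence of the
  -- arguments is needed; the recursion is on the ≅ proof of the results.
  subst-reflects-≅ : ∀ k {a a' bs bs' u u'} → a ≍ a' →
    subst k a bs ≡ just u → subst k a' bs' ≡ just u' → u ≅ u' → a ≅ a' × bs ≅ᴹ bs'
  subst-reflects-≅ k {var y} {bs = bs} {bs'} var e e' d
    with y ≡ᵇ k | varSubst k y bs e | varSubst k y bs' e'
  ... | true  | hit  | hit  = var , perm (_ ∷ []) refl (d ∷ [])
  ... | false | miss | miss = var , perm [] refl []
  subst-reflects-≅ k (lam q) e e' d with mapM-just e | mapM-just e' | d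
  ... | _ , e₁ , refl | _ , e₁' , refl | lam d₁ with subst-reflects-≅ (suc k) q e₁ e₁' d₁
  ... | a≅ , bs≅ = lam a≅ , shiftM-reflects-≅ᴹ 0 bs≅
  subst-reflects-≅ k {app c _} {app c' _} (app q qd) e e' d
    with map2M-just e | map2M-just e' | d
  ... | _ , _ , e₁ , e₂ , refl | _ , _ , e₁' , e₂' , refl | app dc dd
    with subst-reflects-≅ k q e₁ e₁' dc | substM-reflects-≅ᴹ k (≍ᴹ⇒Coherent qd) e₂ e₂' dd
  ... | c≅ , t≅ | d≅ , r≅ = app c≅ d≅ , ≅ᴹ-split (occ k c) (occ k c') t≅ r≅
  subst-reflects-≅ k (plusL q) e e' d with mapM-just e | mapM-just e' | d
  ... | _ , e₁ , refl | _ , e₁' , refl | plusL d₁ with subst-reflects-≅ k q e₁ e₁' d₁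
  ... | a≅ , bs≅ = plusL a≅ , bs≅
  subst-reflects-≅ k (plusR q) e e' d with mapM-just e | mapM-just e' | d
  ... | _ , e₁ , refl | _ , e₁' , refl | plusR d₁ with subst-reflects-≅ k q e₁ e₁' d₁
  ... | a≅ , bs≅ = plusR a≅ , bs≅
  subst-reflects-≅ k plusLR e e' d with mapM-just e | mapM-just e' | d
  ... | _ , _ , refl | _ , _ , refl | ()
  subst-reflects-≅ k plusRL e e' d with mapM-just e | mapM-just e' | d
  ... | _ , _ , refl | _ , _ , refl | ()

  -- The permutation relating the results is pulled back to the chunk lists;
  -- the elements it pairs up are coherent, so the term case applies to them.
  substM-reflects-≅ᴹ : ∀ k {d d' bs bs' u u'} → Coherent (d ++ d') →
    substM k d bs ≡ just u → substM k d' bs' ≡ just u' → u ≅ᴹ u' → d ≅ᴹ d' × bs ≅ᴹ bs'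
  substM-reflects-≅ᴹ k {d} {d'} {bs} {bs'} h e e' (perm cs p w)
    with substM-chunks k d bs e | substM-chunks k d' bs' e'
  ... | ps , refl , refl , sw | ps' , refl , refl , sw' with Pointwise-↭ sw p
  ... | qs , ps↭qs , sw₁ with substs-reflects-≅ k coh-qs-ps' sw₁ sw' w
    where
      coh-qs-ps' : ∀ {p p'} → p ∈ qs → p' ∈ ps' → proj₁ p ≍ proj₁ p'
      coh-qs-ps' p∈ p'∈ = h (∈-++⁺ˡ (∈-map⁺ proj₁ (↭.∈-resp-↭ (↭-sym ps↭qs) p∈)))
                            (∈-++⁺ʳ (map proj₁ ps) (∈-map⁺ proj₁ p'∈))
  ... | heads≅ , chunks≅ =
    perm (map proj₁ qs) (↭.map⁺ proj₁ ps↭qs) heads≅ ,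
    ↭-≅ᴹ (concat-↭ (↭.map⁺ proj₂ ps↭qs)) (≅ᴹ-concat chunks≅)

  substs-reflects-≅ : ∀ k {ps ps' us us'} →
    (∀ {p p'} → p ∈ ps → p' ∈ ps' → proj₁ p ≍ proj₁ p') →
    Pointwise (SubstsTo k) ps us → Pointwise (SubstsTo k) ps' us' → Pointwise _≅_ us us' →
    Pointwise _≅_ (map proj₁ ps) (map proj₁ ps') × Pointwise _≅ᴹ_ (map proj₂ ps) (map proj₂ ps')
  substs-reflects-≅ k h [] [] [] = [] , []
  substs-reflects-≅ k h (e ∷ sw) (e' ∷ sw') (d ∷ w)
    with subst-reflects-≅ k (h (here refl) (here refl)) e e' d
       | substs-reflects-≅ k (λ p∈ p'∈ → h (there p∈) (there p'∈)) sw sw' w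
  ... | a≅ , bs≅ | as≅ , bss≅ = a≅ ∷ as≅ , bs≅ ∷ bss≅

SubstFrom : ℕ → List Term → Term → Term → Set
SubstFrom k U a c = ∃[ ch ] (ch ⊆ U × subst k a ch ≡ just c)

substM-from : ∀ k {U} d bs {u} → bs ⊆ U → substM k d bs ≡ just u → Pointwise (SubstFrom k U) d u
substM-from k [] [] s refl = []
substM-from k (a ∷ d) bs s e with map2M-just e
... | _ , _ , e₁ , e₂ , refl =
  (take (occ k a) bs , take-⊆ₛ (occ k a) s , e₁) ∷ substM-from k d (drop (occ k a) bs) (drop-⊆ₛ (occ k a) s) e₂

mutual
  subst-≍ : ∀ k {U a a' bs bs' u u'} → Coherent U → bs ⊆ U → bs' ⊆ U → a ≍ a' →
    subst k a bs ≡ just u → subst k a' bs' ≡ just u' → u ≍ u'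
  subst-≍ k {a = var y} {bs = bs} {bs'} h s s' var e e'
    with y ≡ᵇ k | varSubst k y bs e | varSubst k y bs' e'
  ... | true  | hit  | hit  = h (s (here refl)) (s' (here refl))
  ... | false | miss | miss = var
  subst-≍ k h s s' (lam q) e e' with mapM-just e | mapM-just e'
  ... | _ , e₁ , refl | _ , e₁' , refl =
    lam (subst-≍ (suc k) (shift-Coherent 0 h) (shift-⊆ 0 s) (shift-⊆ 0 s') q e₁ e₁')
  subst-≍ k {U} {app c dl} {app c' dl'} h s s' (app q (coh A)) e e'
    with map2M-just e | map2M-just e'
  ... | _ , v , e₁ , e₂ , refl | _ , v' , e₁' , e₂' , refl =
    app (subst-≍ k h (take-⊆ₛ (occ k c) s) (take-⊆ₛ (occ k c') s') q e₁ e₁')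
        (coh (subst-AllCoh k h A args args))
    where
      args : Pointwise (SubstFrom k U) (dl ++ dl') (v ++ v')
      args = Pointwise.++⁺ (substM-from k dl _ (drop-⊆ₛ (occ k c) s) e₂)
                           (substM-from k dl' _ (drop-⊆ₛ (occ k c') s') e₂')
  subst-≍ k h s s' (plusL q) e e' with mapM-just e | mapM-just e'
  ... | _ , e₁ , refl | _ , e₁' , refl = plusL (subst-≍ k h s s' q e₁ e₁')
  subst-≍ k h s s' (plusR q) e e' with mapM-just e | mapM-just e'
  ... | _ , e₁ , refl | _ , e₁' , refl = plusR (subst-≍ k h s s' q e₁ e₁')
  subst-≍ k h s s' plusLR e e' with mapM-just e | mapM-just e'
  ... | _ , _ , refl | _ , _ , refl = plusLR
  subst-≍ k h s s' plusRL e e' with mapM-just e | mapM-just e'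
  ... | _ , _ , refl | _ , _ , refl = plusRL

  subst-AllCoh : ∀ k {U xs ys vs ws} → Coherent U → AllCoh xs ys →
    Pointwise (SubstFrom k U) xs vs → Pointwise (SubstFrom k U) ys ws → AllCoh vs ws
  subst-AllCoh k h [] [] _ = []
  subst-AllCoh k h (row ∷ rows) (x↦ ∷ xs↦) ys↦ = subst-All≍ k h x↦ row ys↦ ∷ subst-AllCoh k h rows xs↦ ys↦

  subst-All≍ : ∀ k {U x v ys ws} → Coherent U → SubstFrom k U x v → All (x ≍_) ys →
    Pointwise (SubstFrom k U) ys ws → All (v ≍_) ws
  subst-All≍ k h _ [] [] = []
  subst-All≍ k h x↦@(_ , s , e) (q ∷ qs) ((_ , s' , e') ∷ ys↦) =
    subst-≍ k h s s' q e e' ∷ subst-All≍ k h x↦ qs ys↦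

LtTo : Term → Term → Set
LtTo a c = Lt a ≡ just c

LM-pointwise : ∀ {d u} → LM d ≡ just u → Pointwise LtTo d u
LM-pointwise {[]} refl = []
LM-pointwise {a ∷ d} e with map2M-just e
... | _ , _ , e₁ , e₂ , refl = e₁ ∷ LM-pointwise e₂

varHead-≍ : ∀ {c c'} → c ≍ c' → varHead c ≡ varHead c'
varHead-≍ var = refl
varHead-≍ (lam q) = refl
varHead-≍ (app q _) = varHead-≍ q
varHead-≍ (plusL q) = refl
varHead-≍ (plusR q) = refl
varHead-≍ plusLR = refl
varHead-≍ plusRL = refl

mutual
  -- The rearranging cases are
  -- inverted directly, β-steps go through substitution, and inside monomials
  -- the permutation is pulled back as for substitution.
  Lt-reflects-≅ : ∀ {r r' u u'} → r ≍ r' → Lt r ≡ just u → Lt r' ≡ just u' → u ≅ u' → r ≅ r'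
  Lt-reflects-≅ var refl refl d = var
  Lt-reflects-≅ (lam var) refl refl d = d
  Lt-reflects-≅ (lam (lam q)) e e' d with mapM-just e | mapM-just e' | d
  ... | _ , e₁ , refl | _ , e₁' , refl | lam d₁ = lam (Lt-reflects-≅ (lam q) e₁ e₁' d₁)
  Lt-reflects-≅ (lam (app q qd)) e e' d with mapM-just e | mapM-just e' | d
  ... | _ , e₁ , refl | _ , e₁' , refl | lam d₁ = lam (Lt-reflects-≅ (app q qd) e₁ e₁' d₁)
  Lt-reflects-≅ (lam (plusL q)) refl refl (plusL (lam d)) = lam (plusL d)
  Lt-reflects-≅ (lam (plusR q)) refl refl (plusR (lam d)) = lam (plusR d)
  Lt-reflects-≅ (lam plusLR) refl refl ()
  Lt-reflects-≅ (lam plusRL) refl refl ()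
  Lt-reflects-≅ (app var qd) e e' d with mapM-just e | mapM-just e' | d
  ... | _ , e₁ , refl | _ , e₁' , refl | app _ dd = app var (LM-reflects-≅ᴹ qd e₁ e₁' dd)
  Lt-reflects-≅ (app (lam q) qd) e e' d with subst-reflects-≅ 0 q e e' d
  ... | a≅ , d≅ = app (lam a≅) d≅
  Lt-reflects-≅ (app (plusL q) qd) refl refl (plusL (app da dd)) = app (plusL da) dd
  Lt-reflects-≅ (app (plusR q) qd) refl refl (plusR (app da dd)) = app (plusR da) dd
  Lt-reflects-≅ (app plusLR qd) refl refl ()
  Lt-reflects-≅ (app plusRL qd) refl refl ()
  Lt-reflects-≅ (app (app {c = c} {c'} q qe) qd) e e' d with varHead c | varHead c' | varHead-≍ q
  ... | true | .true | refl with map2M-just e | map2M-just e' | d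
  ...   | _ , _ , e₁ , e₂ , refl | _ , _ , e₁' , e₂' , refl | app d₁ d₂ =
    app (Lt-reflects-≅ (app q qe) e₁ e₁' d₁) (LM-reflects-≅ᴹ qd e₂ e₂' d₂)
  Lt-reflects-≅ (app (app q qe) qd) e e' d | false | .false | refl with mapM-just e | mapM-just e' | d
  ...   | _ , e₁ , refl | _ , e₁' , refl | app d₁ dd = app (Lt-reflects-≅ (app q qe) e₁ e₁' d₁) dd
  Lt-reflects-≅ (plusL q) e e' d with mapM-just e | mapM-just e' | d
  ... | _ , e₁ , refl | _ , e₁' , refl | plusL d₁ = plusL (Lt-reflects-≅ q e₁ e₁' d₁)
  Lt-reflects-≅ (plusR q) e e' d with mapM-just e | mapM-just e' | d
  ... | _ , e₁ , refl | _ , e₁' , refl | plusR d₁ = plusR (Lt-reflects-≅ q e₁ e₁' d₁)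
  Lt-reflects-≅ plusLR e e' d with mapM-just e | mapM-just e' | d
  ... | _ , _ , refl | _ , _ , refl | ()
  Lt-reflects-≅ plusRL e e' d with mapM-just e | mapM-just e' | d
  ... | _ , _ , refl | _ , _ , refl | ()

  LM-reflects-≅ᴹ : ∀ {d d' u u'} → d ≍ᴹ d' → LM d ≡ just u → LM d' ≡ just u' → u ≅ᴹ u' → d ≅ᴹ d'
  LM-reflects-≅ᴹ {d} qd e e' (perm cs p w) with Pointwise-↭ (LM-pointwise e) p
  ... | ds , d↭ds , lw = perm ds d↭ds (Lts-reflects-≅ coh-ds-d' lw (LM-pointwise e') w)
    where
      coh-ds-d' : ∀ {x y} → x ∈ ds → y ∈ _ → x ≍ y
      coh-ds-d' x∈ y∈ = ≍ᴹ⇒Coherent qd (∈-++⁺ˡ (↭.∈-resp-↭ (↭-sym d↭ds) x∈)) (∈-++⁺ʳ d y∈)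

  Lts-reflects-≅ : ∀ {ds ds' us us'} → (∀ {x y} → x ∈ ds → y ∈ ds' → x ≍ y) →
    Pointwise LtTo ds us → Pointwise LtTo ds' us' → Pointwise _≅_ us us' → Pointwise _≅_ ds ds'
  Lts-reflects-≅ h [] [] [] = []
  Lts-reflects-≅ h (e ∷ lw) (e' ∷ lw') (d ∷ w) =
    Lt-reflects-≅ (h (here refl) (here refl)) e e' d
    ∷ Lts-reflects-≅ (λ x∈ y∈ → h (there x∈) (there y∈)) lw lw' w

-- L preserves coherence.  The recursion is on the coherence proof, so the
-- cases are distinguished by views that hand the recursive calls the
-- subproofs themselves rather than rebuilt ones.

lam-view : ∀ {a a'} → a ≍ a' →
  (∀ {u u'} → Lt (lam a) ≡ just u → Lt (lam a') ≡ just u' → u ≍ u') ⊎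
  (Lt (lam a) ≡ mapM lam (Lt a) × Lt (lam a') ≡ mapM lam (Lt a'))
lam-view var = inj₂ (refl , refl)
lam-view (lam q) = inj₂ (refl , refl)
lam-view (app q qd) = inj₂ (refl , refl)
lam-view (plusL q) = inj₁ λ { refl refl → plusL (lam q) }
lam-view (plusR q) = inj₁ λ { refl refl → plusR (lam q) }
lam-view plusLR = inj₁ λ { refl refl → plusLR }
lam-view plusRL = inj₁ λ { refl refl → plusRL }

-- Coherent heads of an application, analysed only as far as L inspects them.
data HeadView : Term → Term → Set where
  var    : ∀ {y} → HeadView (var y) (var y)
  lam    : ∀ {a a'} → a ≍ a' → HeadView (lam a) (lam a')
  plusL  : ∀ {a a'} → a ≍ a' → HeadView (plusL a) (plusL a')
  plusR  : ∀ {a a'} → a ≍ a' → HeadView (plusR a) (plusR a')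
  plusLR : ∀ {a a'} → HeadView (plusL a) (plusR a')
  plusRL : ∀ {a a'} → HeadView (plusR a) (plusL a')
  app    : ∀ {c e c' e'} → varHead c ≡ varHead c' → HeadView (app c e) (app c' e')

head-view : ∀ {c c'} → c ≍ c' → HeadView c c'
head-view var = var
head-view (lam q) = lam q
head-view (app q _) = app (varHead-≍ q)
head-view (plusL q) = plusL q
head-view (plusR q) = plusR q
head-view plusLR = plusLR
head-view plusRL = plusRL

mutual
  Lt-≍ : ∀ {r r' u u'} → r ≍ r' → Lt r ≡ just u → Lt r' ≡ just u' → u ≍ u'
  Lt-≍ var refl refl = var
  Lt-≍ (lam q) e e' with lam-view q
  ... | inj₁ sum-out = sum-out e e'
  ... | inj₂ (eq , eq') with mapM-just (≡-trans (sym eq) e) | mapM-just (≡-trans (sym eq') e')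
  ...   | _ , e₁ , refl | _ , e₁' , refl = lam (Lt-≍ q e₁ e₁')
  Lt-≍ (app q qd) e e' with head-view q
  ... | var with mapM-just e | mapM-just e'
  ...   | _ , e₁ , refl | _ , e₁' , refl = app q (LM-≍ᴹ qd e₁ e₁')
  Lt-≍ (app {d = d} q qd) e e' | lam qa = subst-≍ 0 (≍ᴹ⇒Coherent qd) ∈-++⁺ˡ (∈-++⁺ʳ d) qa e e'
  Lt-≍ (app q qd) refl refl | plusL qa = plusL (app qa qd)
  Lt-≍ (app q qd) refl refl | plusR qa = plusR (app qa qd)
  Lt-≍ (app q qd) refl refl | plusLR = plusLR
  Lt-≍ (app q qd) refl refl | plusRL = plusRL
  Lt-≍ (app q qd) e e' | app {c = c} {c' = c'} same with varHead c | varHead c' | same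
  ... | true | .true | refl with map2M-just e | map2M-just e'
  ...   | _ , _ , e₁ , e₂ , refl | _ , _ , e₁' , e₂' , refl = app (Lt-≍ q e₁ e₁') (LM-≍ᴹ qd e₂ e₂')
  Lt-≍ (app q qd) e e' | app _ | false | .false | refl with mapM-just e | mapM-just e'
  ...   | _ , e₁ , refl | _ , e₁' , refl = app (Lt-≍ q e₁ e₁') qd
  Lt-≍ (plusL q) e e' with mapM-just e | mapM-just e'
  ... | _ , e₁ , refl | _ , e₁' , refl = plusL (Lt-≍ q e₁ e₁')
  Lt-≍ (plusR q) e e' with mapM-just e | mapM-just e'
  ... | _ , e₁ , refl | _ , e₁' , refl = plusR (Lt-≍ q e₁ e₁')
  Lt-≍ plusLR e e' with mapM-just e | mapM-just e'
  ... | _ , _ , refl | _ , _ , refl = plusLR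
  Lt-≍ plusRL e e' with mapM-just e | mapM-just e'
  ... | _ , _ , refl | _ , _ , refl = plusRL

  LM-≍ᴹ : ∀ {d d' u u'} → d ≍ᴹ d' → LM d ≡ just u → LM d' ≡ just u' → u ≍ᴹ u'
  LM-≍ᴹ {d} {d'} {u} {u'} (coh A) e e' = coh (Lt-AllCoh A lw lw)
    where
      lw : Pointwise LtTo (d ++ d') (u ++ u')
      lw = Pointwise.++⁺ (LM-pointwise {d} e) (LM-pointwise {d'} e')

  Lt-AllCoh : ∀ {xs ys vs ws} → AllCoh xs ys → Pointwise LtTo xs vs → Pointwise LtTo ys ws → AllCoh vs ws
  Lt-AllCoh [] [] _ = []
  Lt-AllCoh (row ∷ rows) (e ∷ lw) lw' = Lt-All≍ e row lw' ∷ Lt-AllCoh rows lw lw'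

  Lt-All≍ : ∀ {x v ys ws} → LtTo x v → All (x ≍_) ys → Pointwise LtTo ys ws → All (v ≍_) ws
  Lt-All≍ e [] [] = []
  Lt-All≍ e (q ∷ qs) (e' ∷ lw') = Lt-≍ q e e' ∷ Lt-All≍ e qs lw'

data CohP (s : Sort) : Maybe (Exp s) → Maybe (Exp s) → Set where
  just     : ∀ {r r'} → Coh s r r' → CohP s (just r) (just r')
  nothingˡ : ∀ {y} → CohP s nothing y
  nothingʳ : ∀ {x} → CohP s x nothing

L-reflects-≅ : ∀ s {r r' u u'} → Coh s r r' →
  L s (just r) ≡ just u → L s (just r') ≡ just u' → Cong s u u' → Cong s r r'
L-reflects-≅ tm = Lt-reflects-≅
L-reflects-≅ mono = LM-reflects-≅ᴹ

L-≍ : ∀ s {r r' u u'} → Coh s r r' → L s (just r) ≡ just u → L s (just r') ≡ just u' → Coh s u u'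
L-≍ tm = Lt-≍
L-≍ mono = LM-≍ᴹ

L-preserves-CohP : ∀ s {x y} → CohP s x y → CohP s (L s x) (L s y)
L-preserves-CohP s {just r} {just r'} (just q) with L s (just r) in e | L s (just r') in e'
... | just u  | just u' = just (L-≍ s q e e')
... | nothing | _       = nothingˡ
... | just _  | nothing = nothingʳ
L-preserves-CohP s nothingˡ = nothingˡ
L-preserves-CohP s nothingʳ = nothingʳ

L-reflects-CongP : ∀ s {x y} → CohP s x y → CongP s (L s x) (L s y) → CongP s x y
L-reflects-CongP s {just r} {just r'} (just q) c with L s (just r) in e | L s (just r') in e' | c
... | just u | just u' | just d = just (L-reflects-≅ s q e e' d)

Lⁿ-preserves-CohP : ∀ s n {x y} → CohP s x y → CohP s (Lⁿ s n x) (Lⁿ s n y)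
Lⁿ-preserves-CohP s zero q = q
Lⁿ-preserves-CohP s (suc n) q = L-preserves-CohP s (Lⁿ-preserves-CohP s n q)

Lⁿ-reflects-CongP : ∀ s n {x y} → CohP s x y → CongP s (Lⁿ s n x) (Lⁿ s n y) → CongP s x y
Lⁿ-reflects-CongP s zero q c = c
Lⁿ-reflects-CongP s (suc n) q c =
  Lⁿ-reflects-CongP s n q (L-reflects-CongP s (Lⁿ-preserves-CohP s n q) c)

Lⁿ-stable : ∀ s {r k} → IsNFIndex s r k → ∀ j → Lⁿ s (j + k) (just r) ≡ Lⁿ s k (just r)
Lⁿ-stable s nf zero = refl
Lⁿ-stable s nf (suc j) = ≡-trans (cong (L s) (Lⁿ-stable s nf j)) nf

unjust : ∀ {s r r'} → CongP s (just r) (just r') → Cong s r r'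
unjust (just c) = c

lemma6p6 : (s : Sort) (r r' : Exp s) → Coh s r r' →
    (CongP s (L s (just r)) (L s (just r')) → Cong s r r')
    × ((k k' : ℕ) → IsNFIndex s r k → IsNFIndex s r' k' →
       CongP s (Lⁿ s k (just r)) (Lⁿ s k' (just r')) → Cong s r r')
lemma6p6 s r r' q = one-step , normal-forms
  where
    one-step : CongP s (L s (just r)) (L s (just r')) → Cong s r r'
    one-step c = unjust (L-reflects-CongP s (just q) c)

    -- Both normal forms are the (k' + k)-th iterate.
    normal-forms : (k k' : ℕ) → IsNFIndex s r k → IsNFIndex s r' k' →
      CongP s (Lⁿ s k (just r)) (Lⁿ s k' (just r')) → Cong s r r'
    normal-forms k k' nf nf' c = unjust (Lⁿ-reflects-CongP s (k' + k) (just q) c')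
      where
        r'-stable : Lⁿ s (k' + k) (just r') ≡ Lⁿ s k' (just r')
        r'-stable = ≡-trans (cong (λ n → Lⁿ s n (just r')) (+-comm k' k)) (Lⁿ-stable s nf' k)
        c' : CongP s (Lⁿ s (k' + k) (just r)) (Lⁿ s (k' + k) (just r'))
        c' = subst₂ (CongP s) (sym (Lⁿ-stable s nf k')) (sym r'-stable) c
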